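{- Let $G$ be a block graph with $\mathcal{P}(G)\neq\emptyset$. Then for every $(v,v')\in\mathcal{P}(G)$ and positive integer $m$ such that $S_m(v,v')$ is critical, $S_m(v,v')$ induces a complete subgraph of $G$.
   Context: Graphs are simple and connected; $d$ is the shortest-path distance. A block graph is a graph obtained by starting with a complete graph $K_{n_1}$, $n_1\ge2$, and repeatedly (finitely many times, at least once) adding a complete graph $K_{n_i}$, $n_i\ge2$, identifying one of its vertices with one vertex of the graph built so far (equivalently, a finite connected graph whose blocks are all complete). For a vertex $v$ and positive integer $m$, $S(v,m)=\{w: d(v,w)=m\}$. A vertex separator is a set of vertices whose removal disconnects $G$. For distinct $v,v'$, a common separating subset of their $m$-spheres is a set $S\subseteq S(v,m)\cap S(v',m)$ which is a vertex separator such that some component of $G\setminus S$ contains neither $v$ nor $v'$. $\mathcal{P}_m(G)$ is the set of ordered pairs of distinct vertices whose $m$-spheres have a common separating subset, $\mathcal{P}(G)=\bigcup_m\mathcal{P}_m(G)$. For $(v,v')\in\mathcal{P}_m(G)$, $S_m(v,v')$ is the union of all such subsets, $C_m^j$ ($j\in J$) the components of $G\setminus S_m(v,v')$ containing neither $v$ nor $v'$, $\mu_m(v,v')=|\{w\in V(G)\setminus\bigcup_jC_m^j: d(v,w)\neq d(v',w)\}|$; $\mu_m(G)=\min_{\mathcal{P}_m(G)}\mu_m(v,v')$, $\mu(G)=\min_m\mu_m(G)$. $S_m(v,v')$ is critical if $\mu_m(v,v')=\mu(G)$ and $m=\min\{k\ge1: \mu_k(v,v')=\mu(G)\}$. -}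

module Defs where

open import Data.Nat using (ℕ; zero; suc; _+_; _≤_; _<_)
open import Data.Fin using (Fin; splitAt) renaming (_≟_ to _≟F_)
open import Data.Fin.Subset using (Subset; _∈_; _∉_; ∣_∣)
open import Data.Bool using (Bool; true; false; not)
open import Data.Sum using (_⊎_; inj₁; inj₂)
open import Data.Product using (Σ; ∃; ∃-syntax; _×_; _,_)
open import Relation.Nullary using (¬_)
open import Relation.Nullary.Decidable using (⌊_⌋)
open import Relation.Binary.PropositionalEquality using (_≡_; _≢_)
open import Function.Bundles using (_↔_; Inverse)

Graph : ℕ → Set
Graph n = Fin n → Fin n → Bool

Edge : ∀ {n} → Graph n → Fin n → Fin n → Set
Edge A x y = A x y ≡ true

completeG : (k : ℕ) → Graph k
completeG k x y = not ⌊ x ≟F y ⌋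

-- glue a complete graph K_{suc (suc j)} (j ≥ 0, so size ≥ 2) onto vertex u
-- of A : its suc j new vertices are the right summand of Fin (n + suc j).
glueG : ∀ {n} → Graph n → Fin n → (j : ℕ) → Graph (n + suc j)
glueG {n} A u j x y with splitAt n x | splitAt n y
... | inj₁ a | inj₁ b = A a b
... | inj₁ a | inj₂ _ = ⌊ a ≟F u ⌋
... | inj₂ _ | inj₁ b = ⌊ b ≟F u ⌋
... | inj₂ a | inj₂ b = not ⌊ a ≟F b ⌋

relabelG : ∀ {n} → Graph n → Fin n ↔ Fin n → Graph n
relabelG A σ x y = A (Inverse.to σ x) (Inverse.to σ y)

-- Built g n A : A is obtained (up to relabelling) from a complete graph
-- K_{n₁}, n₁ ≥ 2, by g gluing steps of complete graphs K_{nᵢ}, nᵢ ≥ 2.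
data Built : ℕ → (n : ℕ) → Graph n → Set where
  base    : (j : ℕ) → Built 0 (suc (suc j)) (completeG (suc (suc j)))
  glue    : ∀ {g n A} → Built g n A → (u : Fin n) → (j : ℕ) →
            Built (suc g) (n + suc j) (glueG A u j)
  perm    : ∀ {g n A} → Built g n A → (σ : Fin n ↔ Fin n) →
            Built g n (relabelG A σ)

BlockGraph : (n : ℕ) → Graph n → Set
BlockGraph n A = Σ ℕ λ g → 1 ≤ g × Built g n A

data Walk {n} (A : Graph n) : Fin n → Fin n → ℕ → Set where
  nil  : ∀ {x} → Walk A x x 0
  cons : ∀ {x y z k} → Edge A x y → Walk A y z k → Walk A x z (suc k)

Dist : ∀ {n} → Graph n → Fin n → Fin n → ℕ → Set
Dist A x y m = Walk A x y m × (∀ k → k < m → ¬ Walk A x y k)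

InSphere : ∀ {n} → Graph n → Fin n → ℕ → Fin n → Set
InSphere A v m w = Dist A v w m

DistDiffer : ∀ {n} → Graph n → Fin n → Fin n → Fin n → Set
DistDiffer A v v' w = ¬ (∃[ k ] (Dist A v w k × Dist A v' w k))

-- connectivity in G \ S  (a walk all of whose vertices lie outside S)
-- (S given as a predicate on vertices)
data Reach {n} (A : Graph n) (S : Fin n → Set) : Fin n → Fin n → Set where
  here : ∀ {x} → ¬ S x → Reach A S x x
  step : ∀ {x y z} → ¬ S x → Edge A x y → Reach A S y z → Reach A S x z

VertexSeparator : ∀ {n} → Graph n → Subset n → Set
VertexSeparator {n} A S =
  ∃[ x ] ∃[ y ] (x ∉ S × y ∉ S × ¬ Reach A (_∈ S) x y)

CommonSeparating : ∀ {n} → Graph n → ℕ → Fin n → Fin n → Subset n → Set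
CommonSeparating {n} A m v v' S =
  (∀ w → w ∈ S → InSphere A v m w × InSphere A v' m w)
  × VertexSeparator A S
  × (∃[ w ] (w ∉ S × ¬ Reach A (_∈ S) w v × ¬ Reach A (_∈ S) w v'))

InP : ∀ {n} → Graph n → ℕ → Fin n → Fin n → Set
InP A m v v' = 1 ≤ m × v ≢ v' × ∃[ S ] CommonSeparating A m v v' S

InPAll : ∀ {n} → Graph n → Fin n → Fin n → Set
InPAll A v v' = ∃[ m ] InP A m v v'

InSm : ∀ {n} → Graph n → ℕ → Fin n → Fin n → Fin n → Set
InSm A m v v' w = ∃[ S ] (CommonSeparating A m v v' S × w ∈ S)

-- w ∈ ⋃_j C_m^j : w lies in a component of G \ S_m(v,v') containing
-- neither v nor v'
InComps : ∀ {n} → Graph n → ℕ → Fin n → Fin n → Fin n → Set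
InComps A m v v' w =
  ¬ InSm A m v v' w
  × ¬ Reach A (InSm A m v v') w v
  × ¬ Reach A (InSm A m v v') w v'

IsMu : ∀ {n} → Graph n → ℕ → Fin n → Fin n → ℕ → Set
IsMu {n} A m v v' k =
  InP A m v v' ×
  ∃[ T ] ((∀ w → (w ∈ T → (¬ InComps A m v v' w × DistDiffer A v v' w))
                × ((¬ InComps A m v v' w × DistDiffer A v v' w) → w ∈ T))
          × ∣ T ∣ ≡ k)

IsMuG : ∀ {n} → Graph n → ℕ → Set
IsMuG A k =
  (∃[ m ] ∃[ v ] ∃[ v' ] IsMu A m v v' k)
  × (∀ m v v' k' → IsMu A m v v' k' → k ≤ k')

Critical : ∀ {n} → Graph n → ℕ → Fin n → Fin n → Set
Critical A m v v' =
  ∃[ μG ] (IsMuG A μG × IsMu A m v v' μG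
           × (∀ k → 1 ≤ k → k < m → ¬ IsMu A k v v' μG))

InducesComplete : ∀ {n} → Graph n → (Fin n → Set) → Set
InducesComplete A P = ∀ x y → P x → P y → x ≢ y → Edge A x y

-- Block graphs are exactly the connected graphs in which any two nonadjacent
-- vertices are separated by a single cut vertex. Suppose x and y lie in a
-- critical S_m(v,v') but are not adjacent, and let c separate them. Then c
-- separates x (or y) from v, and x (or y) from v'. If it separates one of them
-- from both, the geodesics from v and v' to it pass through c at a common
-- distance i < m, so {c} is a common separating subset of the i-spheres; since
-- μ_k(v,v') does not depend on k, this contradicts the minimality of m. In the
-- crossed case, comparing the two geodesics through c shows that c is an
-- interior vertex of a geodesic from v' to x, and an interior vertex of a
-- geodesic in a block graph separates its ends, which reduces to the first case.
module Submission where

open import Defs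
open import Data.Bool using (true)
open import Data.Bool.Properties using () renaming (_≟_ to _≟B_)
open import Data.Empty using (⊥; ⊥-elim)
open import Data.Fin using (Fin; splitAt; _↑ˡ_; _↑ʳ_) renaming (_≟_ to _≟F_)
open import Data.Fin.Properties
  using (any?; ↑ˡ-injective; splitAt-↑ˡ; splitAt-↑ʳ; splitAt⁻¹-↑ˡ; splitAt⁻¹-↑ʳ)
open import Data.Fin.Subset using (_∈_; _∉_; ⁅_⁆)
open import Data.Fin.Subset.Properties using (x∈⁅x⁆; x∈⁅y⁆⇒x≡y)
open import Data.Nat using (ℕ; zero; suc; _+_; _≤_; _<_; z≤n; s≤s; _≤?_)
open import Data.Nat.Induction using (<-rec)
open import Data.Nat.Properties
open import Data.Product using (∃; ∃-syntax; _×_; _,_; proj₁; proj₂)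
open import Data.Sum using (_⊎_; inj₁; inj₂; [_,_]′)
open import Function using (_∘_)
open import Function.Bundles using (_↔_; Inverse)
open import Relation.Nullary using (¬_; Dec; yes; no)
open import Relation.Nullary.Decidable using (⌊_⌋; _×-dec_; decidable-stable)
open import Relation.Binary.PropositionalEquality
open import Relation.Unary using (Decidable)

Separates : ∀ {n} → Graph n → Fin n → Fin n → Fin n → Set
Separates A c x y = ¬ Reach A (_≡ c) x y

Equidistant : ∀ {n} → Graph n → Fin n → Fin n → Fin n → Set
Equidistant A v v' w = ∃[ k ] (Dist A v w k × Dist A v' w k)

module WalkProperties {n : ℕ} (A : Graph n) where

  infixr 5 _++ʷ_ _++ʳ_

  _++ʷ_ : ∀ {x y z k l} → Walk A x y k → Walk A y z l → Walk A x z (k + l)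
  nil ++ʷ q = q
  cons e p ++ʷ q = cons e (p ++ʷ q)

  Walk-zero⇒≡ : ∀ {x y} → Walk A x y 0 → x ≡ y
  Walk-zero⇒≡ nil = refl

  unsnoc : ∀ {x y k} → Walk A x y (suc k) → ∃[ b ] (Walk A x b k × Edge A b y)
  unsnoc (cons e nil) = _ , nil , e
  unsnoc (cons e (cons e' w)) with unsnoc (cons e' w)
  ... | b , w' , e'' = b , cons e w' , e''

  walk? : ∀ k x y → Dec (Walk A x y k)
  walk? zero x y with x ≟F y
  ... | yes refl = yes nil
  ... | no x≢y = no (x≢y ∘ Walk-zero⇒≡)
  walk? (suc k) x y with any? (λ z → (A x z ≟B true) ×-dec walk? k z y)
  ... | yes (z , e , w) = yes (cons e w)
  ... | no none = no λ { (cons e w) → none (_ , e , w) }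

  Dist-≤ : ∀ {x y D L} → Dist A x y D → Walk A x y L → D ≤ L
  Dist-≤ {L = L} (_ , shortest) w = ≮⇒≥ λ L<D → shortest L L<D w

  Dist-unique : ∀ {x y D D'} → Dist A x y D → Dist A x y D' → D ≡ D'
  Dist-unique d d' = ≤-antisym (Dist-≤ d (proj₁ d')) (Dist-≤ d' (proj₁ d))

  Dist-pos : ∀ {x y D} → x ≢ y → Dist A x y D → 0 < D
  Dist-pos {D = zero} x≢y (w , _) = ⊥-elim (x≢y (Walk-zero⇒≡ w))
  Dist-pos {D = suc _} _ _ = s≤s z≤n

  equidistant-pos : ∀ {v v' c i} → v ≢ v' → Dist A v c i → Dist A v' c i → 0 < i
  equidistant-pos {i = zero} v≢v' (w , _) (w' , _) =
    ⊥-elim (v≢v' (trans (Walk-zero⇒≡ w) (sym (Walk-zero⇒≡ w'))))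
  equidistant-pos {i = suc _} _ _ _ = s≤s z≤n

  walk⇒Dist : ∀ {x y L} → Walk A x y L → ∃ (Dist A x y)
  walk⇒Dist {x} {y} {L} = <-rec (λ L → Walk A x y L → ∃ (Dist A x y)) shorten L
    where
      shorten : ∀ L → (∀ {k} → k < L → Walk A x y k → ∃ (Dist A x y)) →
                Walk A x y L → ∃ (Dist A x y)
      shorten L recurse w with anyUpTo? (λ k → walk? k x y) L
      ... | yes (k , k<L , w') = recurse k<L w'
      ... | no none = L , w , λ k k<L w' → none (k , k<L , w')

  Dist-split : ∀ {x s y i p} → Dist A x y (i + p) → Walk A x s i → Walk A s y p →
               Dist A x s i × Dist A s y p
  Dist-split {i = i} {p} (_ , shortest) wi wp =
      (wi , λ k k<i w → shortest (k + p) (+-monoˡ-< p k<i) (w ++ʷ wp))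
    , (wp , λ k k<p w → shortest (i + k) (+-monoʳ-< i k<p) (wi ++ʷ w))

  Reach-start : ∀ {P x y} → Reach A P x y → ¬ P x
  Reach-start (here ¬Px) = ¬Px
  Reach-start (step ¬Px _ _) = ¬Px

  Reach-end : ∀ {P x y} → Reach A P x y → ¬ P y
  Reach-end (here ¬Py) = ¬Py
  Reach-end (step _ _ r) = Reach-end r

  _++ʳ_ : ∀ {P x y z} → Reach A P x y → Reach A P y z → Reach A P x z
  here _ ++ʳ r = r
  step ¬Px e r ++ʳ r' = step ¬Px e (r ++ʳ r')

  Reach-mono : ∀ {P Q x y} → (∀ w → Q w → P w) → Reach A P x y → Reach A Q x y
  Reach-mono Q⊆P (here ¬Px) = here (¬Px ∘ Q⊆P _)
  Reach-mono Q⊆P (step ¬Px e r) = step (¬Px ∘ Q⊆P _) e (Reach-mono Q⊆P r)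

  Reach-step-or-stay : ∀ {P x y z} → ¬ P x → Edge A x y ⊎ x ≡ y →
                       Reach A P y z → Reach A P x z
  Reach-step-or-stay ¬Px (inj₁ e) r = step ¬Px e r
  Reach-step-or-stay ¬Px (inj₂ refl) r = r

  WalkThrough : (Fin n → Set) → Fin n → Fin n → ℕ → Set
  WalkThrough P x y L =
    ∃[ s ] ∃[ i ] ∃[ p ] (P s × Walk A x s i × Walk A s y p × i + p ≡ L)

  walk-avoids : ∀ {P x y L} → Walk A x y L → ¬ WalkThrough P x y L → Reach A P x y
  walk-avoids {x = x} nil none = here λ Px → none (x , 0 , 0 , Px , nil , nil , refl)
  walk-avoids {x = x} (cons e w) none =
    step (λ Px → none (x , 0 , _ , Px , nil , cons e w , refl)) e
         (walk-avoids w λ { (s , i , p , Ps , wi , wp , eq) →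
            none (s , suc i , p , Ps , cons e wi , wp , cong suc eq) })

  avoid-or-through : ∀ {P x y L} → Decidable P → Walk A x y L →
                     Reach A P x y ⊎ WalkThrough P x y L
  avoid-or-through {x = x} P? nil with P? x
  ... | yes Px = inj₂ (x , 0 , 0 , Px , nil , nil , refl)
  ... | no ¬Px = inj₁ (here ¬Px)
  avoid-or-through {x = x} P? (cons e w) with P? x
  ... | yes Px = inj₂ (x , 0 , _ , Px , nil , cons e w , refl)
  ... | no ¬Px with avoid-or-through P? w
  ...   | inj₁ r = inj₁ (step ¬Px e r)
  ...   | inj₂ (s , i , p , Ps , wi , wp , eq) =
          inj₂ (s , suc i , p , Ps , cons e wi , wp , cong suc eq)

  avoids-far-from-start : ∀ {a b c k} → (∀ l → l ≤ k → ¬ Walk A a c l) →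
                          Walk A a b k → Reach A (_≡ c) a b
  avoids-far-from-start far w = walk-avoids w λ { (_ , i , p , refl , wi , _ , refl) →
    far i (m≤m+n i p) wi }

  avoids-far-from-end : ∀ {a b c k} → (∀ l → l ≤ k → ¬ Walk A c b l) →
                        Walk A a b k → Reach A (_≡ c) a b
  avoids-far-from-end far w = walk-avoids w λ { (_ , i , p , refl , _ , wp , refl) →
    far p (m≤n+m p i) wp }

module UndirectedWalks {n : ℕ} (A : Graph n)
  (symmetric : ∀ {x y} → Edge A x y → Edge A y x) where
  open WalkProperties A

  reverse-onto : ∀ {x y z k l} → Walk A x y k → Walk A x z l → Walk A y z (k + l)
  reverse-onto nil acc = acc
  reverse-onto {l = l} (cons {k = k} e w) acc =
    subst (Walk A _ _) (+-suc k l) (reverse-onto w (cons (symmetric e) acc))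

  reverse : ∀ {x y k} → Walk A x y k → Walk A y x k
  reverse {k = k} w = subst (Walk A _ _) (+-identityʳ k) (reverse-onto w nil)

  Reach-reverse : ∀ {P x y} → Reach A P x y → Reach A P y x
  Reach-reverse (here ¬Px) = here ¬Px
  Reach-reverse (step ¬Px e r) =
    Reach-reverse r ++ʳ step (Reach-start r) (symmetric e) (here ¬Px)

-- μ_m(v,v') does not depend on m: every vertex of a discarded component is
-- equidistant from v and v'.
module Criticality {n : ℕ} (A : Graph n)
  (symmetric : ∀ {x y} → Edge A x y → Edge A y x)
  (connected : ∀ x y → ∃ (Walk A x y)) where
  open WalkProperties A
  open UndirectedWalks A symmetric

  dist : ∀ x y → ∃ (Dist A x y)
  dist x y = walk⇒Dist (proj₂ (connected x y))

  dist-≤-beyond-equidistant : ∀ (P : Fin n → Set) {v v' w D D'} →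
    (∀ s → P s → Equidistant A v v' s) → ¬ Reach A P w v' →
    Dist A v w D → Dist A v' w D' → D ≤ D'
  dist-≤-beyond-equidistant P {D = D} {D'} equi sep dv dv' =
    decidable-stable (D ≤? D') λ D≰D' → sep (walk-avoids (reverse (proj₁ dv'))
      λ { (s , i , p , Ps , ws , wv' , i+p≡D') →
        let (j , dvs , dv's) = equi s Ps in
        D≰D' (begin
          D      ≤⟨ Dist-≤ dv (proj₁ dvs ++ʷ reverse ws) ⟩
          j + i  ≤⟨ +-monoˡ-≤ i (Dist-≤ dv's (reverse wv')) ⟩
          p + i  ≡⟨ trans (+-comm p i) i+p≡D' ⟩
          D'     ∎) })
    where open ≤-Reasoning

  separated-from-both⇒equidistant : ∀ (P : Fin n → Set) {v v' w} →
    (∀ s → P s → Equidistant A v v' s) → ¬ Reach A P w v → ¬ Reach A P w v' →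
    Equidistant A v v' w
  separated-from-both⇒equidistant P {v} {v'} {w} equi sep sep' =
    let (D , dv) = dist v w
        (D' , dv') = dist v' w
        equi' s Ps = let (j , dvs , dv's) = equi s Ps in j , dv's , dvs
        D≡D' = ≤-antisym (dist-≤-beyond-equidistant P equi sep' dv dv')
                         (dist-≤-beyond-equidistant P equi' sep dv' dv)
    in D , dv , subst (Dist A v' w) (sym D≡D') dv'

  InComps⇒equidistant : ∀ {m v v' w} → InComps A m v v' w → Equidistant A v v' w
  InComps⇒equidistant {m} {v} {v'} (_ , sep , sep') =
    separated-from-both⇒equidistant (InSm A m v v') onSpheres sep sep'
    where
      onSpheres : ∀ s → InSm A m v v' s → Equidistant A v v' s
      onSpheres s (_ , (spheres , _) , s∈S) = m , spheres s s∈S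

  IsMu-reindex : ∀ {m k v v' μ} → IsMu A m v v' μ → InP A k v v' → IsMu A k v v' μ
  IsMu-reindex (_ , T , spec , card) inP = inP , T , spec' , card
    where
      spec' = λ w →
          (λ w∈T → let (_ , differ) = proj₁ (spec w) w∈T in
                   (λ inComps → differ (InComps⇒equidistant inComps)) , differ)
        , (λ (_ , differ) →
             proj₂ (spec w) ((λ inComps → differ (InComps⇒equidistant inComps)) , differ))

  Critical⇒minimal : ∀ {m v v'} → Critical A m v v' → ∀ k → 1 ≤ k → k < m → ¬ InP A k v v'
  Critical⇒minimal (_ , _ , isMu , minimal) k 1≤k k<m inP =
    minimal k 1≤k k<m (IsMu-reindex isMu inP)

exchanged-sums-≡ : ∀ i i' p q {m} → i + p ≡ m → i' + q ≡ m →
                   m ≤ i' + p → m ≤ i + q → i ≡ i'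
exchanged-sums-≡ i i' p q i+p≡m i'+q≡m m≤i'+p m≤i+q =
  ≤-antisym (+-cancelʳ-≤ p i i' (subst (_≤ i' + p) (sym i+p≡m) m≤i'+p))
            (+-cancelʳ-≤ q i' i (subst (_≤ i + q) (sym i'+q≡m) m≤i+q))

module CutVertices {n : ℕ} (A : Graph n)
  (symmetric : ∀ {x y} → Edge A x y → Edge A y x)
  (cutVertex : ∀ a b → a ≢ b → ¬ Edge A a b → ∃[ c ] (c ≢ a × c ≢ b × Separates A c a b)) where
  open WalkProperties A
  open UndirectedWalks A symmetric

  geodesic-through : ∀ {v x c m} → Dist A v x m → Separates A c x v →
                     ∃[ i ] ∃[ p ] (Dist A v c i × Dist A c x p × i + p ≡ m)
  geodesic-through {c = c} d@(w , _) sep with avoid-or-through (_≟F c) w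
  ... | inj₁ r = ⊥-elim (sep (Reach-reverse r))
  ... | inj₂ (_ , i , p , refl , wi , wp , refl) =
        let (dvc , dcx) = Dist-split d wi wp in i , p , dvc , dcx , refl

  common-neighbour-separates : ∀ {a b c} → a ≢ b → ¬ Edge A a b →
                               Edge A a c → Edge A c b → Separates A c a b
  common-neighbour-separates {a} {b} {c} a≢b ¬ab ac cb r with cutVertex a b a≢b ¬ab
  ... | c' , c'≢a , c'≢b , sep with c' ≟F c
  ...   | yes refl = sep r
  ...   | no c'≢c = sep (step (c'≢a ∘ sym) ac (step (c'≢c ∘ sym) cb (here (c'≢b ∘ sym))))

  geodesic-interior-separates : ∀ {a b c i p} → Dist A a b (i + p) →
    Dist A a c i → Dist A c b p → 0 < i → 0 < p → Separates A c a b
  geodesic-interior-separates {i = suc i} {suc p} (_ , shortest) (wac , fromA) (wcb , fromC)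
                              (s≤s z≤n) (s≤s z≤n) r
    with unsnoc wac | wcb
  ... | cm , wam , em | cons {y = cp} ep wpb =
    common-neighbour-separates (λ { refl → shortcut nil z≤n }) (λ e → shortcut (cons e nil) ≤-refl)
                               em ep
      (Reach-reverse (avoids-far-from-start (λ l l≤i → fromA l (s≤s l≤i)) wam)
       ++ʳ r ++ʳ
       Reach-reverse (avoids-far-from-end (λ l l≤p → fromC l (s≤s l≤p)) wpb))
    where
      shortcut : ∀ {l} → Walk A cm cp l → l ≤ 1 → ⊥
      shortcut {l} w l≤1 =
        shortest (i + (l + p)) (s≤s (+-monoʳ-≤ i (+-monoˡ-≤ p l≤1))) (wam ++ʷ w ++ʷ wpb)

  singleton-InP : ∀ {v v' c x i} → v ≢ v' → Dist A v c i → Dist A v' c i → c ≢ x →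
                  Separates A c x v → Separates A c x v' → InP A i v v'
  singleton-InP {v} {v'} {c} {x} {i} v≢v' dvc dv'c c≢x sep sep' =
    0<i , v≢v' , ⁅ c ⁆ ,
    (λ w w∈c → subst (λ z → Dist A v z i × Dist A v' z i) (sym (x∈⁅y⁆⇒x≡y c w∈c)) (dvc , dv'c)) ,
    (x , v , ∉⁅c⁆ c≢x , ∉⁅c⁆ v≢c , avoiding sep) ,
    (x , ∉⁅c⁆ c≢x , avoiding sep , avoiding sep')
    where
      ∉⁅c⁆ : ∀ {w} → c ≢ w → w ∉ ⁅ c ⁆
      ∉⁅c⁆ c≢w w∈ = c≢w (sym (x∈⁅y⁆⇒x≡y c w∈))

      0<i = equidistant-pos v≢v' dvc dv'c

      v≢c : c ≢ v
      v≢c refl = proj₂ dvc 0 0<i nil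

      avoiding : ∀ {a b} → Separates A c a b → ¬ Reach A (_∈ ⁅ c ⁆) a b
      avoiding sep r = sep (Reach-mono (λ w w≡c → subst (_∈ ⁅ c ⁆) (sym w≡c) (x∈⁅x⁆ c)) r)

  separated-from-both⇒earlier-InP : ∀ {v v' x c m} → v ≢ v' →
    Dist A v x m → Dist A v' x m → c ≢ x → Separates A c x v → Separates A c x v' →
    ∃[ i ] (1 ≤ i × i < m × InP A i v v')
  separated-from-both⇒earlier-InP v≢v' dvx dv'x c≢x sep sep'
    with geodesic-through dvx sep | geodesic-through dv'x sep'
  ... | i , p , dvc , dcx , i+p≡m | i' , p' , dv'c , dcx' , i'+p'≡m
    with Dist-unique dcx dcx'
  ... | refl with +-cancelʳ-≡ p i i' (trans i+p≡m (sym i'+p'≡m))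
  ... | refl = i , equidistant-pos v≢v' dvc dv'c
             , subst (i <_) i+p≡m (m<m+n i (Dist-pos c≢x dcx))
             , singleton-InP v≢v' dvc dv'c c≢x sep sep'

  crossed-separation : ∀ {v v' x y c m} → v ≢ v' →
    Dist A v x m → Dist A v' x m → Dist A v y m → Dist A v' y m → c ≢ x →
    Separates A c x v → Separates A c y v' → Separates A c x v'
  crossed-separation {v' = v'} {x} v≢v' dvx dv'x dvy dv'y c≢x sep sep'
    with geodesic-through dvx sep | geodesic-through dv'y sep'
  ... | i , p , dvc , dcx , i+p≡m | i' , q , dv'c , dcy , i'+q≡m
    with exchanged-sums-≡ i i' p q i+p≡m i'+q≡m (Dist-≤ dv'x (proj₁ dv'c ++ʷ proj₁ dcx))
                                        (Dist-≤ dvy (proj₁ dvc ++ʷ proj₁ dcy))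
  ... | refl = geodesic-interior-separates (subst (Dist A v' x) (sym i+p≡m) dv'x) dv'c dcx
                 (equidistant-pos v≢v' dvc dv'c) (Dist-pos c≢x dcx)
               ∘ Reach-reverse

  nonadjacent-in-sphere⇒earlier-InP : ∀ {v v' x y m} → v ≢ v' →
    Dist A v x m → Dist A v' x m → Dist A v y m → Dist A v' y m → x ≢ y → ¬ Edge A x y →
    ¬ ¬ (∃[ i ] (1 ≤ i × i < m × InP A i v v'))
  nonadjacent-in-sphere⇒earlier-InP {v} {v'} {x} {y} v≢v' dvx dv'x dvy dv'y x≢y ¬xy none
    with cutVertex x y x≢y ¬xy
  ... | c , c≢x , c≢y , sep =
        separates-x-or-y v λ sv → separates-x-or-y v' λ sv' → cases sv sv'
    where
      separates-x-or-y : ∀ t → ¬ ¬ (Separates A c x t ⊎ Separates A c y t)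
      separates-x-or-y t k = k (inj₁ λ rxt → k (inj₂ λ ryt → sep (rxt ++ʳ Reach-reverse ryt)))

      from-both : ∀ {z} → Dist A v z _ → Dist A v' z _ → c ≢ z →
                  Separates A c z v → Separates A c z v' → ⊥
      from-both dvz dv'z c≢z s s' = none (separated-from-both⇒earlier-InP v≢v' dvz dv'z c≢z s s')

      cases : Separates A c x v ⊎ Separates A c y v → Separates A c x v' ⊎ Separates A c y v' → ⊥
      cases (inj₁ svx) (inj₁ sv'x) = from-both dvx dv'x c≢x svx sv'x
      cases (inj₂ svy) (inj₂ sv'y) = from-both dvy dv'y c≢y svy sv'y
      cases (inj₁ svx) (inj₂ sv'y) =
        from-both dvx dv'x c≢x svx (crossed-separation v≢v' dvx dv'x dvy dv'y c≢x svx sv'y)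
      cases (inj₂ svy) (inj₁ sv'x) =
        from-both dvx dv'x c≢x (crossed-separation (v≢v' ∘ sym) dv'x dvx dv'y dvy c≢x sv'x svy) sv'x

record CutVertexSeparable {n : ℕ} (A : Graph n) : Set where
  field
    symmetric : ∀ {x y} → Edge A x y → Edge A y x
    connected : ∀ x y → ∃ (Walk A x y)
    cutVertex : ∀ a b → a ≢ b → ¬ Edge A a b → ∃[ c ] (c ≢ a × c ≢ b × Separates A c a b)

≟-true : ∀ {k} {x y : Fin k} → x ≡ y → ⌊ x ≟F y ⌋ ≡ true
≟-true {x = x} {y} x≡y with x ≟F y
... | yes _ = refl
... | no x≢y = ⊥-elim (x≢y x≡y)

≟-true⁻¹ : ∀ {k} {x y : Fin k} → ⌊ x ≟F y ⌋ ≡ true → x ≡ y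
≟-true⁻¹ {x = x} {y} eq with x ≟F y
... | yes x≡y = x≡y

completeG-edge : ∀ {k} {x y : Fin k} → x ≢ y → Edge (completeG k) x y
completeG-edge {x = x} {y} x≢y with x ≟F y
... | yes x≡y = ⊥-elim (x≢y x≡y)
... | no _ = refl

completeG-edge⁻¹ : ∀ {k} {x y : Fin k} → Edge (completeG k) x y → x ≢ y
completeG-edge⁻¹ {x = x} {y} e with x ≟F y
... | no x≢y = x≢y

completeG-separable : ∀ k → CutVertexSeparable (completeG k)
completeG-separable k = record
  { symmetric = λ e → completeG-edge (completeG-edge⁻¹ e ∘ sym)
  ; connected = connected
  ; cutVertex = λ a b a≢b ¬ab → ⊥-elim (¬ab (completeG-edge a≢b))
  }
  where
    connected : ∀ x y → ∃ (Walk (completeG k) x y)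
    connected x y with x ≟F y
    ... | yes refl = 0 , nil
    ... | no x≢y = 1 , cons (completeG-edge x≢y) nil

module Gluing {n : ℕ} (A : Graph n) (u : Fin n) (j : ℕ) where
  open WalkProperties using (_++ʷ_; Reach-start; Reach-end; Reach-step-or-stay)

  G : Graph (n + suc j)
  G = glueG A u j

  old : Fin n → Fin (n + suc j)
  old a = a ↑ˡ suc j

  new : Fin (suc j) → Fin (n + suc j)
  new t = n ↑ʳ t

  old-injective : ∀ {a b} → old a ≡ old b → a ≡ b
  old-injective {a} {b} = ↑ˡ-injective (suc j) a b

  old≢new : ∀ a t → old a ≢ new t
  old≢new a t eq
    with trans (sym (splitAt-↑ˡ n a (suc j))) (trans (cong (splitAt n) eq) (splitAt-↑ʳ n (suc j) t))
  ... | ()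

  data View : Fin (n + suc j) → Set where
    isOld : ∀ a → View (old a)
    isNew : ∀ t → View (new t)

  view : ∀ x → View x
  view x with splitAt n x in eq
  ... | inj₁ a = subst View (splitAt⁻¹-↑ˡ eq) (isOld a)
  ... | inj₂ t = subst View (splitAt⁻¹-↑ʳ eq) (isNew t)

  edge-old-old : ∀ a b → G (old a) (old b) ≡ A a b
  edge-old-old a b rewrite splitAt-↑ˡ n a (suc j) | splitAt-↑ˡ n b (suc j) = refl

  edge-old-new : ∀ a t → G (old a) (new t) ≡ ⌊ a ≟F u ⌋
  edge-old-new a t rewrite splitAt-↑ˡ n a (suc j) | splitAt-↑ʳ n (suc j) t = refl

  edge-new-old : ∀ t b → G (new t) (old b) ≡ ⌊ b ≟F u ⌋
  edge-new-old t b rewrite splitAt-↑ˡ n b (suc j) | splitAt-↑ʳ n (suc j) t = refl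

  edge-new-new : ∀ t t' → G (new t) (new t') ≡ completeG (suc j) t t'
  edge-new-new t t' rewrite splitAt-↑ʳ n (suc j) t | splitAt-↑ʳ n (suc j) t' = refl

  squash : Fin (n + suc j) → Fin n
  squash x = [ (λ a → a) , (λ _ → u) ]′ (splitAt n x)

  squash-old : ∀ a → squash (old a) ≡ a
  squash-old a rewrite splitAt-↑ˡ n a (suc j) = refl

  squash-new : ∀ t → squash (new t) ≡ u
  squash-new t rewrite splitAt-↑ʳ n (suc j) t = refl

  squash-edge : ∀ {x y} → Edge G x y → Edge A (squash x) (squash y) ⊎ squash x ≡ squash y
  squash-edge {x} {y} e with view x | view y
  ... | isOld a | isOld b rewrite squash-old a | squash-old b =
        inj₁ (trans (sym (edge-old-old a b)) e)
  ... | isOld a | isNew t rewrite squash-old a | squash-new t =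
        inj₂ (≟-true⁻¹ (trans (sym (edge-old-new a t)) e))
  ... | isNew t | isOld b rewrite squash-old b | squash-new t =
        inj₂ (sym (≟-true⁻¹ (trans (sym (edge-new-old t b)) e)))
  ... | isNew t | isNew t' rewrite squash-new t | squash-new t' = inj₂ refl

  edge-into-new : ∀ {x} t → Edge G x (new t) → squash x ≡ u
  edge-into-new {x} t e with view x
  ... | isOld a = trans (squash-old a) (≟-true⁻¹ (trans (sym (edge-old-new a t)) e))
  ... | isNew t' = squash-new t'

  squash-≢ : ∀ {c x y} → y ≢ old c → Edge G x y → squash x ≢ c → squash y ≢ c
  squash-≢ {y = y} y≢c e sx≢c with view y
  ... | isOld a = λ sy≡c → y≢c (cong old (trans (sym (squash-old a)) sy≡c))
  ... | isNew t = λ sy≡c → sx≢c (trans (edge-into-new t e) (trans (sym (squash-new t)) sy≡c))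

  squash-reach : ∀ {c x y} → Reach G (_≡ old c) x y → squash x ≢ c →
                 Reach A (_≡ c) (squash x) (squash y)
  squash-reach (here _) sx≢c = here sx≢c
  squash-reach (step _ e r) sx≢c =
    Reach-step-or-stay A sx≢c (squash-edge e) (squash-reach r (squash-≢ (Reach-start G r) e sx≢c))

  lift : ∀ {a b L} → Walk A a b L → Walk G (old a) (old b) L
  lift nil = nil
  lift (cons {x = a} {y = b} e w) = cons (trans (edge-old-old a b) e) (lift w)

  to-squash : ∀ x → ∃ (Walk G x (old (squash x)))
  to-squash x with view x
  ... | isOld a rewrite squash-old a = 0 , nil
  ... | isNew t rewrite squash-new t = 1 , cons (trans (edge-new-old t u) (≟-true refl)) nil

  separable : CutVertexSeparable A → CutVertexSeparable G
  separable S = record { symmetric = symmetricG ; connected = connectedG ; cutVertex = cutVertexG }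
    where
      open CutVertexSeparable S
      open UndirectedWalks

      symmetricG : ∀ {x y} → Edge G x y → Edge G y x
      symmetricG {x} {y} e with view x | view y
      ... | isOld a | isOld b =
            trans (edge-old-old b a) (symmetric (trans (sym (edge-old-old a b)) e))
      ... | isOld a | isNew t = trans (edge-new-old t a) (trans (sym (edge-old-new a t)) e)
      ... | isNew t | isOld b = trans (edge-old-new b t) (trans (sym (edge-new-old t b)) e)
      ... | isNew t | isNew t' =
            let t≢t' = completeG-edge⁻¹ (trans (sym (edge-new-new t t')) e)
            in trans (edge-new-new t' t) (completeG-edge (t≢t' ∘ sym))

      connectedG : ∀ x y → ∃ (Walk G x y)
      connectedG x y =
        let (_ , wx) = to-squash x
            (_ , wy) = to-squash y
            (_ , w) = connected (squash x) (squash y)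
        in _ , _++ʷ_ G wx (_++ʷ_ G (lift w) (reverse G symmetricG wy))

      cutVertex-old : ∀ a y → old a ≢ y → ¬ Edge G (old a) y →
                      ∃[ c ] (c ≢ old a × c ≢ y × Separates G c (old a) y)
      cutVertex-old a y a≢y ¬ay with view y
      ... | isOld b =
            let (c , c≢a , c≢b , sep) =
                  cutVertex a b (a≢y ∘ cong old) (¬ay ∘ trans (edge-old-old a b))
                unsquash = subst₂ (Reach A (_≡ c)) (squash-old a) (squash-old b)
            in old c , c≢a ∘ old-injective , c≢b ∘ old-injective ,
               λ r → sep (unsquash (squash-reach r (c≢a ∘ sym ∘ trans (sym (squash-old a)))))
      ... | isNew t =
            let a≢u = ¬ay ∘ trans (edge-old-new a t) ∘ ≟-true
            in old u , a≢u ∘ sym ∘ old-injective , old≢new u t ,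
               λ r → Reach-end A (squash-reach r (a≢u ∘ trans (sym (squash-old a)))) (squash-new t)

      cutVertexG : ∀ x y → x ≢ y → ¬ Edge G x y → ∃[ c ] (c ≢ x × c ≢ y × Separates G c x y)
      cutVertexG x y x≢y ¬xy with view x | view y
      ... | isOld a | _ = cutVertex-old a y x≢y ¬xy
      ... | isNew t | isOld b =
            let (c , c≢b , c≢x , sep) = cutVertex-old b x (x≢y ∘ sym) (¬xy ∘ symmetricG)
            in c , c≢x , c≢b , sep ∘ Reach-reverse G symmetricG
      ... | isNew t | isNew t' =
            ⊥-elim (¬xy (trans (edge-new-new t t') (completeG-edge (x≢y ∘ cong new))))

module Relabelling {n : ℕ} (A : Graph n) (σ : Fin n ↔ Fin n) where
  open Inverse σ

  R : Graph n
  R = relabelG A σ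

  from-walk : ∀ {a b L} → Walk A a b L → Walk R (from a) (from b) L
  from-walk nil = nil
  from-walk (cons {x = a} {y = b} e w) =
    cons (subst₂ (Edge A) (sym (strictlyInverseˡ a)) (sym (strictlyInverseˡ b)) e) (from-walk w)

  to-≡⇒≡-from : ∀ {x c} → to x ≡ c → x ≡ from c
  to-≡⇒≡-from {x} tx≡c = trans (sym (strictlyInverseʳ x)) (cong from tx≡c)

  to-reach : ∀ {c x y} → Reach R (_≡ from c) x y → Reach A (_≡ c) (to x) (to y)
  to-reach (here ¬x≡c) = here (¬x≡c ∘ to-≡⇒≡-from)
  to-reach (step ¬x≡c e r) = step (¬x≡c ∘ to-≡⇒≡-from) e (to-reach r)

  separable : CutVertexSeparable A → CutVertexSeparable R
  separable S = record
    { symmetric = symmetric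
    ; connected = λ x y →
        let (_ , w) = connected (to x) (to y)
        in _ , subst₂ (λ a b → Walk R a b _) (strictlyInverseʳ x) (strictlyInverseʳ y)
                      (from-walk w)
    ; cutVertex = λ x y x≢y ¬xy →
        let (c , c≢x , c≢y , sep) = cutVertex (to x) (to y) (x≢y ∘ to-injective) ¬xy
        in from c , c≢x ∘ to-from , c≢y ∘ to-from , sep ∘ to-reach
    }
    where
      open CutVertexSeparable S
      to-injective : ∀ {x y} → to x ≡ to y → x ≡ y
      to-injective {y = y} eq = trans (to-≡⇒≡-from eq) (strictlyInverseʳ y)
      to-from : ∀ {c x} → from c ≡ x → c ≡ to x
      to-from {c} eq = trans (sym (strictlyInverseˡ c)) (cong to eq)

Built⇒separable : ∀ {g n A} → Built g n A → CutVertexSeparable A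
Built⇒separable (base j) = completeG-separable (suc (suc j))
Built⇒separable (glue {A = A} b u j) = Gluing.separable A u j (Built⇒separable b)
Built⇒separable (perm {A = A} b σ) = Relabelling.separable A σ (Built⇒separable b)

InSm⇒onSpheres : ∀ {n} {A : Graph n} {m v v' w} →
                 InSm A m v v' w → InSphere A v m w × InSphere A v' m w
InSm⇒onSpheres (_ , (onSpheres , _) , w∈S) = onSpheres _ w∈S

lemma3p19 : (n : ℕ) (A : Graph n) → BlockGraph n A
    → (∃[ v ] ∃[ v' ] InPAll A v v')
    → (v v' : Fin n) (m : ℕ) → InP A m v v'
    → Critical A m v v'
    → InducesComplete A (InSm A m v v')
lemma3p19 n A (_ , _ , built) _ v v' m (_ , v≢v' , _) critical x y x∈S y∈S x≢y
  with InSm⇒onSpheres x∈S | InSm⇒onSpheres y∈S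
... | dvx , dv'x | dvy , dv'y =
  decidable-stable (A x y ≟B true) λ ¬xy →
    nonadjacent-in-sphere⇒earlier-InP v≢v' dvx dv'x dvy dv'y x≢y ¬xy
      λ (i , 1≤i , i<m , inP) → Critical⇒minimal critical i 1≤i i<m inP
  where
    open CutVertexSeparable (Built⇒separable built)
    open Criticality A symmetric connected
    open CutVertices A symmetric cutVertex
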